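{- For every graph $G$, $\chi_B(G)\le\chi(G)+\chi(\overline{G})-1$. Moreover, equality holds for $G=K_p^q$ (for all positive integers $p,q$).
   Context: $\chi$ is the chromatic number and $\overline{G}$ the complement of $G$. $K_p^q$ denotes the complete $p$-partite graph with each part of size $q$. A clique is a vertex set inducing a complete graph, a coclique a vertex set inducing an edgeless graph. The binary chromatic number $\chi_B(G)$ is the least integer $k+1$ such that for every $c\in\{0,\dots,k+1\}$ there is a partition of $V(G)$ into $c$ cliques and $k+1-c$ cocliques (parts may be empty). -}

module Defs where

open import Data.Nat using (ℕ; zero; suc; _+_; _*_; _∸_; _≤_)
open import Data.Fin using (Fin; quotient)
open import Data.Sum using (_⊎_; inj₁; inj₂)
open import Data.Product using (Σ; _×_; ∃; _,_)
open import Relation.Nullary using (¬_)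
open import Relation.Binary.PropositionalEquality using (_≡_; _≢_)

record Graph (n : ℕ) : Set₁ where
  field
    Adj   : Fin n → Fin n → Set
    sym   : ∀ {u v} → Adj u v → Adj v u
    irrefl : ∀ {u} → ¬ Adj u u
open Graph public

complement : ∀ {n} → Graph n → Graph n
complement G = record
  { Adj    = λ u v → (u ≢ v) × ¬ Adj G u v
  ; sym    = λ { (u≢v , ¬a) → (λ e → u≢v (Relation.Binary.PropositionalEquality.sym e)) , (λ a → ¬a (Graph.sym G a)) }
  ; irrefl = λ { (u≢u , _) → u≢u Relation.Binary.PropositionalEquality.refl }
  }

Colourable : ∀ {n} → Graph n → ℕ → Set
Colourable {n} G k = Σ (Fin n → Fin k) λ f → ∀ u v → Adj G u v → f u ≢ f v

IsChromaticNumber : ∀ {n} → Graph n → ℕ → Set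
IsChromaticNumber G k = Colourable G k × (∀ m → Colourable G m → k ≤ m)

-- Partition of V(G) into c cliques and d cocliques (parts may be empty):
-- f assigns each vertex to a clique part (inj₁ i) or a coclique part (inj₂ j).
CliqueCocliquePartition : ∀ {n} → Graph n → ℕ → ℕ → Set
CliqueCocliquePartition {n} G c d =
  Σ (Fin n → Fin c ⊎ Fin d) λ f →
    (∀ u v i → u ≢ v → f u ≡ inj₁ i → f v ≡ inj₁ i → Adj G u v) ×
    (∀ u v j → f u ≡ inj₂ j → f v ≡ inj₂ j → ¬ Adj G u v)

-- m = k+1 works: for every c ∈ {0,…,m} there is a partition into
-- c cliques and m - c cocliques.
BinaryGood : ∀ {n} → Graph n → ℕ → Set
BinaryGood G m = ∀ c → c ≤ m → CliqueCocliquePartition G c (m ∸ c)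

IsBinaryChromaticNumber : ∀ {n} → Graph n → ℕ → Set
IsBinaryChromaticNumber G b =
  (1 ≤ b × BinaryGood G b) × (∀ m → 1 ≤ m → BinaryGood G m → b ≤ m)

-- Complete p-partite graph K_p^q with parts of size q, on vertex set Fin (p * q);
-- vertex x lies in part (quotient q x), and vertices are adjacent iff in different parts.
completeMultipartite : (p q : ℕ) → Graph (p * q)
completeMultipartite p q = record
  { Adj    = λ u v → quotient {p} q u ≢ quotient {p} q v
  ; sym    = λ ne e → ne (Relation.Binary.PropositionalEquality.sym e)
  ; irrefl = λ ne → ne Relation.Binary.PropositionalEquality.refl
  }

{-# OPTIONS --safe #-}
-- Given a proper k-colouring of G and a proper l-colouring of its complement,
-- for c ≥ l the l colour classes of the complement are cliques, and for c < l
-- the k colour classes of G fit into the k + l - 1 - c ≥ k coclique slots.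
-- In K_p^q a clique meets each of the p parts (cocliques of size q) at most
-- once and a coclique lies inside one part, so with fewer than q cliques every
-- part needs a coclique of its own; hence p + q - 1 ≤ χ_B, while p colours
-- suffice for K_p^q and q for its complement.
module Submission where

open import Defs
open import Data.Nat using (ℕ; _+_; _∸_; _≤_; _*_)
open import Data.Product using (_×_)
open import Relation.Binary.PropositionalEquality using (_≡_)

open import Data.Nat using (zero; suc; _<_; _⊓_; _⊔_; s≤s; z≤n; _≤?_)
open import Data.Nat.Properties
  using (≤-trans; ≤-antisym; ≰⇒>; ≮⇒≥; m≤m+n; m≤n+m; +-suc; +-comm; +-∸-assoc;
         +-mono-≤; *-mono-≤; ∸-monoˡ-≤; n∸n≡0; ∸-distribˡ-⊓-⊔; m⊓n≤n; m⊓n≤m;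
         m<n+o⇒m∸n<o; module ≤-Reasoning)
open import Data.Fin using (Fin; zero; suc; inject≤; combine; quotient; remainder; remQuot)
open import Data.Fin.Properties
  using (inject≤-injective; pigeonhole; combine-injectiveʳ; combine-remQuot; remQuot-combine)
import Data.Fin.Properties as Finₚ
open import Data.Product using (Σ; ∃₂; _,_; proj₁; proj₂; uncurry)
open import Data.Sum using (_⊎_; inj₁; inj₂)
open import Data.Sum.Properties using (inj₁-injective; inj₂-injective)
open import Function using (_∘_)
open import Relation.Binary using (Decidable)
open import Relation.Nullary using (¬_; yes; no; contradiction)
open import Relation.Nullary.Decidable using (decidable-stable; ¬¬-excluded-middle)
open import Relation.Nullary.Negation using (¬¬-map)
open import Relation.Binary.PropositionalEquality
  using (_≢_; trans; cong; cong₂; subst; module ≡-Reasoning)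
import Relation.Binary.PropositionalEquality as ≡

¬¬-∀-Fin : ∀ n {P : Fin n → Set} → (∀ i → ¬ ¬ P i) → ¬ ¬ (∀ i → P i)
¬¬-∀-Fin zero    _   ¬∀P = ¬∀P λ ()
¬¬-∀-Fin (suc n) ¬¬P ¬∀P =
  ¬¬P zero λ P₀ → ¬¬-∀-Fin n (¬¬P ∘ suc) λ P₊ → ¬∀P λ { zero → P₀ ; (suc i) → P₊ i }

¬¬-decidable : ∀ {n} (R : Fin n → Fin n → Set) → ¬ ¬ Decidable R
¬¬-decidable {n} R = ¬¬-∀-Fin n λ _ → ¬¬-∀-Fin n λ _ → ¬¬-excluded-middle

m≤m+n∸1∸o : ∀ m {n o} → o < n → m ≤ m + n ∸ 1 ∸ o
m≤m+n∸1∸o m {suc n} {o} (s≤s o≤n) = begin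
  m                 ≤⟨ m≤m+n m (n ∸ o) ⟩
  m + (n ∸ o)       ≡⟨ +-∸-assoc m o≤n ⟨
  m + n ∸ o         ≡⟨ cong (λ x → x ∸ 1 ∸ o) (+-suc m n) ⟨
  m + suc n ∸ 1 ∸ o ∎
  where open ≤-Reasoning

1≤m+n∸1 : ∀ {m n} → 1 ≤ m → 1 ≤ n → 1 ≤ m + n ∸ 1
1≤m+n∸1 {suc m} {n} _ 1≤n = ≤-trans 1≤n (m≤n+m n m)

1≤colours : ∀ {n k} (G : Graph n) → 1 ≤ n → Colourable G k → 1 ≤ k
1≤colours {suc _} {zero}  _ _ (f , _) = contradiction (f zero) λ ()
1≤colours {suc _} {suc _} _ _ _       = s≤s z≤n

module _ {n} (G : Graph n) where

  colourClasses-cocliques : ∀ {k c d} → Colourable G k → k ≤ d →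
                            CliqueCocliquePartition G c d
  colourClasses-cocliques (f , proper) k≤d = inj₂ ∘ embed , (λ _ _ _ _ ()) , coclique
    where
    embed : Fin n → Fin _
    embed u = inject≤ (f u) k≤d

    coclique : ∀ u v j → inj₂ (embed u) ≡ inj₂ j → inj₂ (embed v) ≡ inj₂ j → ¬ Adj G u v
    coclique u v _ eqᵤ eqᵥ uv = proper u v uv
      (inject≤-injective k≤d k≤d _ _ (inj₂-injective (trans eqᵤ (≡.sym eqᵥ))))

  colourClasses-cliques : ∀ {l c d} → Decidable (Adj G) → Colourable (complement G) l →
                          l ≤ c → CliqueCocliquePartition G c d
  colourClasses-cliques adj? (f , proper) l≤c = inj₁ ∘ embed , clique , (λ _ _ _ ())
    where
    embed : Fin n → Fin _
    embed u = inject≤ (f u) l≤c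

    clique : ∀ u v i → u ≢ v → inj₁ (embed u) ≡ inj₁ i → inj₁ (embed v) ≡ inj₁ i → Adj G u v
    clique u v _ u≢v eqᵤ eqᵥ = decidable-stable (adj? u v) λ ¬uv → proper u v (u≢v , ¬uv)
      (inject≤-injective l≤c l≤c _ _ (inj₁-injective (trans eqᵤ (≡.sym eqᵥ))))

  binaryGood-colourings : ∀ {k l} → Decidable (Adj G) → Colourable G k →
                          Colourable (complement G) l → BinaryGood G (k + l ∸ 1)
  binaryGood-colourings {k} {l} adj? χ χᶜ c _ with l ≤? c
  ... | yes l≤c = colourClasses-cliques adj? χᶜ l≤c
  ... | no  l≰c = colourClasses-cocliques χ (m≤m+n∸1∸o k (≰⇒> l≰c))

-- Adjacency is not assumed decidable, but on a finite vertex set its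
-- decidability holds up to double negation, and the goal is decidable.
χB≤χ+χᶜ∸1 : ∀ {n b k l} (G : Graph n) → 1 ≤ n → IsBinaryChromaticNumber G b →
            Colourable G k → Colourable (complement G) l → b ≤ k + l ∸ 1
χB≤χ+χᶜ∸1 {b = b} {k} {l} G 1≤n (_ , least) χ χᶜ =
  decidable-stable (b ≤? k + l ∸ 1) (¬¬-map goodSum (¬¬-decidable (Adj G)))
  where
  goodSum : Decidable (Adj G) → b ≤ k + l ∸ 1
  goodSum adj? = least _ (1≤m+n∸1 (1≤colours G 1≤n χ) (1≤colours (complement G) 1≤n χᶜ))
                         (binaryGood-colourings G adj? χ χᶜ)

all-inj₁-or-some-inj₂ : ∀ {A B : Set} n (h : Fin n → A ⊎ B) →
  (Σ (Fin n → A) λ g → ∀ r → h r ≡ inj₁ (g r)) ⊎ (∃₂ λ r y → h r ≡ inj₂ y)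
all-inj₁-or-some-inj₂ zero    h = inj₁ ((λ ()) , λ ())
all-inj₁-or-some-inj₂ (suc n) h with h zero in h₀ | all-inj₁-or-some-inj₂ n (h ∘ suc)
... | inj₂ y | _                = inj₂ (zero , y , h₀)
... | inj₁ _ | inj₂ (r , y , hr) = inj₂ (suc r , y , hr)
... | inj₁ x | inj₁ (g , hg)     =
  inj₁ ((λ { zero → x ; (suc r) → g r }) , λ { zero → h₀ ; (suc r) → hg r })

quotient-combine : ∀ {p} q (a : Fin p) (r : Fin q) → quotient q (combine a r) ≡ a
quotient-combine q a r = cong proj₁ (remQuot-combine a r)

quotient-remainder-injective : ∀ {p} q {u v : Fin (p * q)} →
  quotient {p} q u ≡ quotient q v → remainder {p} q u ≡ remainder {p} q v → u ≡ v
quotient-remainder-injective {p} q {u} {v} sameQuot sameRem = begin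
  u                                 ≡⟨ combine-remQuot {p} q u ⟨
  uncurry combine (remQuot {p} q u) ≡⟨ cong (uncurry combine) (cong₂ _,_ sameQuot sameRem) ⟩
  uncurry combine (remQuot {p} q v) ≡⟨ combine-remQuot {p} q v ⟩
  v                                 ∎
  where open ≡-Reasoning

completeMultipartite-colourable : ∀ p q → Colourable (completeMultipartite p q) p
completeMultipartite-colourable p q = quotient {p} q , λ _ _ differentParts → differentParts

complement-completeMultipartite-colourable :
  ∀ p q → Colourable (complement (completeMultipartite p q)) q
complement-completeMultipartite-colourable p q = remainder {p} q ,
  λ { u v (u≢v , ¬differentParts) sameRem →
        ¬differentParts λ sameQuot → u≢v (quotient-remainder-injective {p} q sameQuot sameRem) }

every-part-meets-coclique : ∀ {p q c d} → c < q →
  ((f , _) : CliqueCocliquePartition (completeMultipartite p q) c d) →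
  ∀ a → ∃₂ λ r j → f (combine a r) ≡ inj₂ j
every-part-meets-coclique {q = q} c<q (f , clique , _) a
  with all-inj₁-or-some-inj₂ q (f ∘ combine a)
... | inj₂ hit = hit
... | inj₁ (g , fg) =
  let r , s , r<s , gr≡gs = pigeonhole c<q g
  in  contradiction (trans (quotient-combine q a r) (≡.sym (quotient-combine q a s)))
        (clique (combine a r) (combine a s) (g r)
          (Finₚ.<⇒≢ r<s ∘ combine-injectiveʳ a r a s)
          (fg r) (trans (fg s) (cong inj₁ (≡.sym gr≡gs))))

completeMultipartite-¬partition : ∀ {p q c d} → c < q → d < p →
  ¬ CliqueCocliquePartition (completeMultipartite p q) c d
completeMultipartite-¬partition {q = q} c<q d<p P@(_ , _ , coclique) =
  let a , a′ , a<a′ , sameCoclique = pigeonhole d<p (proj₁ ∘ proj₂ ∘ meet)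
      r , j , fr = meet a
      r′ , _ , fr′ = meet a′
  in  coclique (combine a r) (combine a′ r′) j fr
        (trans fr′ (cong inj₂ (≡.sym sameCoclique)))
        (λ sameQuot → Finₚ.<⇒≢ a<a′
          (trans (≡.sym (quotient-combine q a r)) (trans sameQuot (quotient-combine q a′ r′))))
  where
  meet : ∀ a → ∃₂ λ r j → proj₁ P (combine a r) ≡ inj₂ j
  meet = every-part-meets-coclique c<q P

completeMultipartite-binaryGood⇒ : ∀ {p q b} → 1 ≤ p → 1 ≤ q →
  BinaryGood (completeMultipartite p q) b → p + q ∸ 1 ≤ b
completeMultipartite-binaryGood⇒ {suc p} {suc q} {b} _ _ good = ≮⇒≥ λ b<p+q∸1 →
  completeMultipartite-¬partition (s≤s (m⊓n≤n b q)) (d<p b<p+q∸1) (good (b ⊓ q) (m⊓n≤m b q))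
  where
  d<p : b < p + suc q → b ∸ (b ⊓ q) < suc p
  d<p b< = begin-strict
    b ∸ (b ⊓ q)       ≡⟨ ∸-distribˡ-⊓-⊔ b b q ⟩
    (b ∸ b) ⊔ (b ∸ q) ≡⟨ cong (_⊔ (b ∸ q)) (n∸n≡0 b) ⟩
    b ∸ q             <⟨ m<n+o⇒m∸n<o b q (subst (b <_) (trans (+-suc p q) (+-comm (suc p) q)) b<) ⟩
    suc p             ∎
    where open ≤-Reasoning

χB-completeMultipartite : ∀ {p q b k l} → 1 ≤ p → 1 ≤ q →
  IsBinaryChromaticNumber (completeMultipartite p q) b →
  IsChromaticNumber (completeMultipartite p q) k →
  IsChromaticNumber (complement (completeMultipartite p q)) l →
  b ≡ k + l ∸ 1
χB-completeMultipartite {p} {q} {b} {k} {l} 1≤p 1≤q χB (χ , χ-least) (χᶜ , χᶜ-least) =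
  ≤-antisym (χB≤χ+χᶜ∸1 (completeMultipartite p q) (*-mono-≤ 1≤p 1≤q) χB χ χᶜ) (begin
    k + l ∸ 1 ≤⟨ ∸-monoˡ-≤ 1 (+-mono-≤ (χ-least p (completeMultipartite-colourable p q))
                                       (χᶜ-least q (complement-completeMultipartite-colourable p q))) ⟩
    p + q ∸ 1 ≤⟨ completeMultipartite-binaryGood⇒ 1≤p 1≤q (proj₂ (proj₁ χB)) ⟩
    b         ∎)
  where open ≤-Reasoning

proposition4p2 :
    ((n : ℕ) → 1 ≤ n → (G : Graph n) → (b k l : ℕ) →
      IsBinaryChromaticNumber G b → IsChromaticNumber G k →
      IsChromaticNumber (complement G) l →
      b ≤ k + l ∸ 1)
    ×
    ((p q : ℕ) → 1 ≤ p → 1 ≤ q → (b k l : ℕ) →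
      IsBinaryChromaticNumber (completeMultipartite p q) b →
      IsChromaticNumber (completeMultipartite p q) k →
      IsChromaticNumber (complement (completeMultipartite p q)) l →
      b ≡ k + l ∸ 1)
proposition4p2 =
  (λ _ 1≤n G _ _ _ χB χ χᶜ → χB≤χ+χᶜ∸1 G 1≤n χB (proj₁ χ) (proj₁ χᶜ)) ,
  (λ _ _ 1≤p 1≤q _ _ _ → χB-completeMultipartite 1≤p 1≤q)
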